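{- In Ending Partizan Subtraction Nim with a finite removable set $S$ and any terminal rule $W$, the outcome sequence $(\mathcal{O}_S(n))_{n\in\mathbb{Z}_{\ge0}}$ is periodic: there exist $A\in\mathbb{Z}_{\ge0}$ and $p\in\mathbb{Z}_{\ge1}$ such that $\mathcal{O}_S(m+p)=\mathcal{O}_S(m)$ for all $m\ge A$.
   Context: Ending Partizan Subtraction Nim with removable set $S$ (a non-empty set of positive integers) and terminal rule $W$: a position is a number $n\in\mathbb{Z}_{\ge0}$ of tokens; players Left and Right alternate, a move from $n$ removes $s\in S$ tokens with $s\le n$. Positions with no move (i.e. $n<\min S$) are terminal, and $W$ assigns to each terminal position a value in $\{\mathcal{L},\mathcal{R},\mathcal{N},\mathcal{P}\}$: if the game ends at terminal $n$ (player to move cannot move), then Left wins if $W(n)=\mathcal{L}$, Right wins if $W(n)=\mathcal{R}$, the player to move loses if $W(n)=\mathcal{P}$, and the player to move wins if $W(n)=\mathcal{N}$. The outcome $\mathcal{O}_S(n)$ is $\mathcal{L}$ (resp. $\mathcal{R}$) if Left (resp. Right) has a winning strategy from $n$ both moving first and moving second, $\mathcal{N}$ if the first player (whichever) has a winning strategy, and $\mathcal{P}$ if the second player (whichever) has one. -}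

module Defs where

open import Data.Nat using (ℕ; _≤_; _<_; _∸_)
open import Data.List using (List)
open import Data.List.Membership.Propositional using (_∈_)
open import Data.Product using (Σ; _×_; ∃-syntax)
open import Data.Unit using (⊤)
open import Data.Empty using (⊥)

data Outcome : Set where
  𝓛 𝓡 𝓝 𝓟 : Outcome

data Player : Set where
  Left Right : Player

opp : Player → Player
opp Left  = Right
opp Right = Left

-- A removable set S is given as a finite list of naturals
-- (nonemptiness and positivity are hypotheses of the theorem).

Terminal : List ℕ → ℕ → Set
Terminal S n = ∀ s → s ∈ S → n < s

MoverWinsAt : Player → Outcome → Set
MoverWinsAt Left  𝓛 = ⊤
MoverWinsAt Right 𝓛 = ⊥
MoverWinsAt Left  𝓡 = ⊥
MoverWinsAt Right 𝓡 = ⊤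
MoverWinsAt _     𝓝 = ⊤
MoverWinsAt _     𝓟 = ⊥

MoverLosesAt : Player → Outcome → Set
MoverLosesAt Left  𝓛 = ⊥
MoverLosesAt Right 𝓛 = ⊤
MoverLosesAt Left  𝓡 = ⊤
MoverLosesAt Right 𝓡 = ⊥
MoverLosesAt _     𝓝 = ⊥
MoverLosesAt _     𝓟 = ⊤

mutual
  data Wins (S : List ℕ) (W : ℕ → Outcome) : Player → ℕ → Set where
    wins-terminal : ∀ {p n} → Terminal S n → MoverWinsAt p (W n) → Wins S W p n
    wins-move     : ∀ {p n} s → s ∈ S → s ≤ n → Loses S W (opp p) (n ∸ s) → Wins S W p n

  data Loses (S : List ℕ) (W : ℕ → Outcome) : Player → ℕ → Set where
    loses-terminal : ∀ {p n} → Terminal S n → MoverLosesAt p (W n) → Loses S W p n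
    loses-moves    : ∀ {p n} → (∃[ s ] (s ∈ S × s ≤ n)) →
                     (∀ s → s ∈ S → s ≤ n → Wins S W (opp p) (n ∸ s)) → Loses S W p n

-- HasOutcome S W n o : the outcome 𝓞_S(n) is o.
--   𝓛 : Left wins moving first and moving second (Right moving first loses)
--   𝓡 : Right wins moving first and moving second
--   𝓝 : the player moving first wins (either one)
--   𝓟 : the player moving second wins (either one)
HasOutcome : List ℕ → (ℕ → Outcome) → ℕ → Outcome → Set
HasOutcome S W n 𝓛 = Wins S W Left n × Loses S W Right n
HasOutcome S W n 𝓡 = Loses S W Left n × Wins S W Right n
HasOutcome S W n 𝓝 = Wins S W Left n × Wins S W Right n
HasOutcome S W n 𝓟 = Loses S W Left n × Loses S W Right n

-- From a position n ≥ max S every move is legal, so whether the player to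
-- move wins from n depends only on the outcomes of the max S positions just
-- below n.  The outcome sequence thus obeys a recurrence of bounded memory
-- over a four-element set; by pigeonhole two of its windows of length max S
-- coincide, and from then on the sequence repeats with the distance between
-- them as period.

module Submission where

open import Defs
open import Data.Nat using (ℕ; zero; suc; _+_; _∸_; _^_; _≤_; _<_; _≥_; _≤?_; z<s)
open import Data.Nat.Properties
  using (≤-trans; <⇒≤; <⇒≱; ≰⇒>; n<1+n; m≤m+n; m≤n⇒m≤o+n; +-assoc; ∸-monoʳ-<;
         m<n⇒0<n∸m; m+[n∸m]≡n; m∸n+n≡m)
open import Data.Nat.Induction using (<-rec)
open import Data.Fin using (Fin; toℕ; fromℕ<; funToFin; finToFun)
open import Data.Fin.Patterns using (0F; 1F; 2F; 3F)
open import Data.Fin.Properties using (pigeonhole; toℕ-fromℕ<; finToFun-funToFin)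
open import Data.List using (List; []; _∷_)
open import Data.List.Membership.Propositional using (_∈_; find)
open import Data.List.Relation.Unary.All as All using (All)
open import Data.List.Relation.Unary.Any using (here)
open import Data.List.Extrema.Nat using (xs≤max)
open import Data.Product using (_×_; _,_; proj₁; proj₂; ∃; ∃-syntax)
open import Data.Sum as Sum using (_⊎_; inj₁; inj₂)
open import Data.Empty using (⊥-elim)
open import Data.Unit using (tt)
open import Function.Bundles using (_⇔_; mk⇔; _↣_; mk↣; module Injection)
open import Relation.Nullary using (¬_; yes; no; contradiction)
open import Relation.Binary.PropositionalEquality
  using (_≡_; _≢_; refl; sym; trans; cong; module ≡-Reasoning)

private
  variable
    A : Set
    S : List ℕ
    W : ℕ → Outcome
    p : Player
    n x y : ℕ

module _ (M : ℕ) (f : ℕ → A) where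

  WindowsAgree : ℕ → ℕ → Set
  WindowsAgree a b = ∀ k → k < M → f (a ∸ suc k) ≡ f (b ∸ suc k)

  DeterminedByWindow : Set
  DeterminedByWindow = ∀ {a b} → M ≤ a → M ≤ b → WindowsAgree a b → f a ≡ f b

EventuallyPeriodic : (ℕ → A) → Set
EventuallyPeriodic f = ∃[ n₀ ] ∃[ p ] (1 ≤ p × (∀ m → m ≥ n₀ → f (m + p) ≡ f m))

module _ {M : ℕ} {f : ℕ → A} (determined : DeterminedByWindow M f) where

  windowsAgree-suc : ∀ {a b} → M ≤ a → M ≤ b → WindowsAgree M f a b →
                     WindowsAgree M f (suc a) (suc b)
  windowsAgree-suc M≤a M≤b agree zero    _     = determined M≤a M≤b agree
  windowsAgree-suc M≤a M≤b agree (suc k) 1+k<M = agree k (<⇒≤ 1+k<M)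

  windowsAgree-+ : ∀ {a b} → M ≤ a → M ≤ b → WindowsAgree M f a b →
                   ∀ t → WindowsAgree M f (t + a) (t + b)
  windowsAgree-+ M≤a M≤b agree zero    = agree
  windowsAgree-+ M≤a M≤b agree (suc t) =
    windowsAgree-suc (m≤n⇒m≤o+n t M≤a) (m≤n⇒m≤o+n t M≤b) (windowsAgree-+ M≤a M≤b agree t)

  windowsAgree⇒agree-after : ∀ {a b} → M ≤ a → M ≤ b → WindowsAgree M f a b →
                             ∀ t → f (t + a) ≡ f (t + b)
  windowsAgree⇒agree-after M≤a M≤b agree t =
    determined (m≤n⇒m≤o+n t M≤a) (m≤n⇒m≤o+n t M≤b) (windowsAgree-+ M≤a M≤b agree t)

module _ {k : ℕ} (code : A ↣ Fin k) (M : ℕ) (f : ℕ → A) where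
  open Injection code using (to; injective)

  window : ℕ → Fin (k ^ M)
  window n = funToFin (λ (j : Fin M) → to (f (n ∸ suc (toℕ j))))

  window-injective : ∀ {a b} → window a ≡ window b → WindowsAgree M f a b
  window-injective {a} {b} same i i<M = injective (begin
    to (f (a ∸ suc i))       ≡⟨ entry a ⟨
    finToFun (window a) j    ≡⟨ cong (λ w → finToFun w j) same ⟩
    finToFun (window b) j    ≡⟨ entry b ⟩
    to (f (b ∸ suc i))       ∎)
    where
    open ≡-Reasoning
    j = fromℕ< i<M
    entry : ∀ n → finToFun (window n) j ≡ to (f (n ∸ suc i))
    entry n = trans (finToFun-funToFin (λ (j′ : Fin M) → to (f (n ∸ suc (toℕ j′)))) j)
                    (cong (λ i′ → to (f (n ∸ suc i′))) (toℕ-fromℕ< i<M))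

determinedByWindow⇒eventuallyPeriodic : ∀ {k M} {f : ℕ → A} → A ↣ Fin k →
                                        DeterminedByWindow M f → EventuallyPeriodic f
determinedByWindow⇒eventuallyPeriodic {k = k} {M} {f} code determined
  with pigeonhole (n<1+n (k ^ M)) (λ t → window code M f (M + toℕ t))
... | i , j , i<j , sameWindow = a , period , m<n⇒0<n∸m i<j , periodic
  where
  open ≡-Reasoning
  a = M + toℕ i
  b = M + toℕ j
  period = toℕ j ∸ toℕ i

  a+period≡b : a + period ≡ b
  a+period≡b = trans (+-assoc M (toℕ i) period) (cong (M +_) (m+[n∸m]≡n (<⇒≤ i<j)))

  periodic : ∀ m → m ≥ a → f (m + period) ≡ f m
  periodic m a≤m = begin
    f (m + period)      ≡⟨ cong (λ x → f (x + period)) (m∸n+n≡m a≤m) ⟨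
    f (t + a + period)  ≡⟨ cong f (trans (+-assoc t a period) (cong (t +_) a+period≡b)) ⟩
    f (t + b)           ≡⟨ windowsAgree⇒agree-after determined (m≤m+n M _) (m≤m+n M _)
                             (window-injective code M f {a} {b} sameWindow) t ⟨
    f (t + a)           ≡⟨ cong f (m∸n+n≡m a≤m) ⟩
    f m                 ∎
    where t = m ∸ a

outcomeIndex : Outcome → Fin 4
outcomeIndex 𝓛 = 0F
outcomeIndex 𝓡 = 1F
outcomeIndex 𝓝 = 2F
outcomeIndex 𝓟 = 3F

outcomeOfIndex : Fin 4 → Outcome
outcomeOfIndex 0F = 𝓛
outcomeOfIndex 1F = 𝓡
outcomeOfIndex 2F = 𝓝
outcomeOfIndex 3F = 𝓟

outcomeOfIndex-outcomeIndex : ∀ o → outcomeOfIndex (outcomeIndex o) ≡ o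
outcomeOfIndex-outcomeIndex 𝓛 = refl
outcomeOfIndex-outcomeIndex 𝓡 = refl
outcomeOfIndex-outcomeIndex 𝓝 = refl
outcomeOfIndex-outcomeIndex 𝓟 = refl

Outcome↣Fin4 : Outcome ↣ Fin 4
Outcome↣Fin4 = mk↣ λ {o} {o′} same → begin
  o                                   ≡⟨ outcomeOfIndex-outcomeIndex o ⟨
  outcomeOfIndex (outcomeIndex o)     ≡⟨ cong outcomeOfIndex same ⟩
  outcomeOfIndex (outcomeIndex o′)    ≡⟨ outcomeOfIndex-outcomeIndex o′ ⟩
  o′                                  ∎
  where open ≡-Reasoning

moverWinsAt⊎moverLosesAt : ∀ p w → MoverWinsAt p w ⊎ MoverLosesAt p w
moverWinsAt⊎moverLosesAt Left  𝓛 = inj₁ tt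
moverWinsAt⊎moverLosesAt Left  𝓡 = inj₂ tt
moverWinsAt⊎moverLosesAt Left  𝓝 = inj₁ tt
moverWinsAt⊎moverLosesAt Left  𝓟 = inj₂ tt
moverWinsAt⊎moverLosesAt Right 𝓛 = inj₂ tt
moverWinsAt⊎moverLosesAt Right 𝓡 = inj₁ tt
moverWinsAt⊎moverLosesAt Right 𝓝 = inj₁ tt
moverWinsAt⊎moverLosesAt Right 𝓟 = inj₂ tt

moverWinsAt⇒¬moverLosesAt : ∀ p w → MoverWinsAt p w → ¬ MoverLosesAt p w
moverWinsAt⇒¬moverLosesAt Left  𝓛 _ ()
moverWinsAt⇒¬moverLosesAt Left  𝓡 ()
moverWinsAt⇒¬moverLosesAt Left  𝓝 _ ()
moverWinsAt⇒¬moverLosesAt Left  𝓟 ()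
moverWinsAt⇒¬moverLosesAt Right 𝓛 ()
moverWinsAt⇒¬moverLosesAt Right 𝓡 _ ()
moverWinsAt⇒¬moverLosesAt Right 𝓝 _ ()
moverWinsAt⇒¬moverLosesAt Right 𝓟 ()

Wins⇒¬Loses : Wins S W p n → ¬ Loses S W p n
Wins⇒¬Loses (wins-terminal _ w)      (loses-terminal _ l)            = moverWinsAt⇒¬moverLosesAt _ _ w l
Wins⇒¬Loses (wins-terminal t _)      (loses-moves (s , s∈S , s≤n) _) = <⇒≱ (t s s∈S) s≤n
Wins⇒¬Loses (wins-move s s∈S s≤n _) (loses-terminal t _)            = <⇒≱ (t s s∈S) s≤n
Wins⇒¬Loses (wins-move s s∈S s≤n l) (loses-moves _ w)               = Wins⇒¬Loses (w s s∈S s≤n) l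

classify : Wins S W Left n ⊎ Loses S W Left n → Wins S W Right n ⊎ Loses S W Right n →
           ∃ (HasOutcome S W n)
classify (inj₁ wL) (inj₁ wR) = 𝓝 , wL , wR
classify (inj₁ wL) (inj₂ lR) = 𝓛 , wL , lR
classify (inj₂ lL) (inj₁ wR) = 𝓡 , lL , wR
classify (inj₂ lL) (inj₂ lR) = 𝓟 , lL , lR

HasOutcome-unique : ∀ o o′ → HasOutcome S W n o → HasOutcome S W n o′ → o ≡ o′
HasOutcome-unique 𝓛 𝓛 _        _        = refl
HasOutcome-unique 𝓛 𝓡 (w , _)  (l , _)  = ⊥-elim (Wins⇒¬Loses w l)
HasOutcome-unique 𝓛 𝓝 (_ , l)  (_ , w)  = ⊥-elim (Wins⇒¬Loses w l)
HasOutcome-unique 𝓛 𝓟 (w , _)  (l , _)  = ⊥-elim (Wins⇒¬Loses w l)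
HasOutcome-unique 𝓡 𝓛 (l , _)  (w , _)  = ⊥-elim (Wins⇒¬Loses w l)
HasOutcome-unique 𝓡 𝓡 _        _        = refl
HasOutcome-unique 𝓡 𝓝 (l , _)  (w , _)  = ⊥-elim (Wins⇒¬Loses w l)
HasOutcome-unique 𝓡 𝓟 (_ , w)  (_ , l)  = ⊥-elim (Wins⇒¬Loses w l)
HasOutcome-unique 𝓝 𝓛 (_ , w)  (_ , l)  = ⊥-elim (Wins⇒¬Loses w l)
HasOutcome-unique 𝓝 𝓡 (w , _)  (l , _)  = ⊥-elim (Wins⇒¬Loses w l)
HasOutcome-unique 𝓝 𝓝 _        _        = refl
HasOutcome-unique 𝓝 𝓟 (w , _)  (l , _)  = ⊥-elim (Wins⇒¬Loses w l)
HasOutcome-unique 𝓟 𝓛 (l , _)  (w , _)  = ⊥-elim (Wins⇒¬Loses w l)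
HasOutcome-unique 𝓟 𝓡 (_ , l)  (_ , w)  = ⊥-elim (Wins⇒¬Loses w l)
HasOutcome-unique 𝓟 𝓝 (l , _)  (w , _)  = ⊥-elim (Wins⇒¬Loses w l)
HasOutcome-unique 𝓟 𝓟 _        _        = refl

Wins-resp-HasOutcome : ∀ o p → HasOutcome S W x o → HasOutcome S W y o →
                       Wins S W p x → Wins S W p y
Wins-resp-HasOutcome 𝓛 Left  _       (w , _) _ = w
Wins-resp-HasOutcome 𝓛 Right (_ , l) _       w = ⊥-elim (Wins⇒¬Loses w l)
Wins-resp-HasOutcome 𝓡 Left  (l , _) _       w = ⊥-elim (Wins⇒¬Loses w l)
Wins-resp-HasOutcome 𝓡 Right _       (_ , w) _ = w
Wins-resp-HasOutcome 𝓝 Left  _       (w , _) _ = w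
Wins-resp-HasOutcome 𝓝 Right _       (_ , w) _ = w
Wins-resp-HasOutcome 𝓟 Left  (l , _) _       w = ⊥-elim (Wins⇒¬Loses w l)
Wins-resp-HasOutcome 𝓟 Right (_ , l) _       w = ⊥-elim (Wins⇒¬Loses w l)

Loses-resp-HasOutcome : ∀ o p → HasOutcome S W x o → HasOutcome S W y o →
                        Loses S W p x → Loses S W p y
Loses-resp-HasOutcome 𝓛 Left  (w , _) _       l = ⊥-elim (Wins⇒¬Loses w l)
Loses-resp-HasOutcome 𝓛 Right _       (_ , l) _ = l
Loses-resp-HasOutcome 𝓡 Left  _       (l , _) _ = l
Loses-resp-HasOutcome 𝓡 Right (_ , w) _       l = ⊥-elim (Wins⇒¬Loses w l)
Loses-resp-HasOutcome 𝓝 Left  (w , _) _       l = ⊥-elim (Wins⇒¬Loses w l)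
Loses-resp-HasOutcome 𝓝 Right (_ , w) _       l = ⊥-elim (Wins⇒¬Loses w l)
Loses-resp-HasOutcome 𝓟 Left  _       (l , _) _ = l
Loses-resp-HasOutcome 𝓟 Right _       (_ , l) _ = l

HasOutcome-map : (∀ {p} → Wins S W p x → Wins S W p y) → (∀ {p} → Loses S W p x → Loses S W p y) →
                 ∀ o → HasOutcome S W x o → HasOutcome S W y o
HasOutcome-map wins loses 𝓛 (a , b) = wins a  , loses b
HasOutcome-map wins loses 𝓡 (a , b) = loses a , wins b
HasOutcome-map wins loses 𝓝 (a , b) = wins a  , wins b
HasOutcome-map wins loses 𝓟 (a , b) = loses a , loses b

module _ {S : List ℕ} (W : ℕ → Outcome) (positive : All (0 <_) S) where

  terminal⇒Wins⊎Loses : Terminal S n → Wins S W p n ⊎ Loses S W p n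
  terminal⇒Wins⊎Loses {n} {p} t =
    Sum.map (wins-terminal t) (loses-terminal t) (moverWinsAt⊎moverLosesAt p (W n))

  -- The premise 0 < s is what lets the recursion reach n ∸ s < n; for
  -- moves in S it is supplied by positivity.
  classifyMove : (∀ {m} → m < n → ∀ q → Wins S W q m ⊎ Loses S W q m) → ∀ p s →
                 (0 < s → s ≤ n → Wins S W (opp p) (n ∸ s)) ⊎ (s ≤ n × Loses S W (opp p) (n ∸ s))
  classifyMove         ih p zero        = inj₁ λ ()
  classifyMove {n = n} ih p s@(suc _) with s ≤? n
  ... | no  s≰n = inj₁ λ _ s≤n → contradiction s≤n s≰n
  ... | yes s≤n = Sum.map (λ w _ _ → w) (s≤n ,_) (ih (∸-monoʳ-< z<s s≤n) (opp p))

  Wins⊎Loses : ∀ n p → Wins S W p n ⊎ Loses S W p n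
  Wins⊎Loses = <-rec _ step
    where
    step : ∀ n → (∀ {m} → m < n → ∀ q → Wins S W q m ⊎ Loses S W q m) →
           ∀ p → Wins S W p n ⊎ Loses S W p n
    step n ih p with All.search (_≤? n) S
    ... | inj₁ noMove = terminal⇒Wins⊎Loses λ s s∈S → ≰⇒> (All.lookup noMove s∈S)
    ... | inj₂ someMove with All.decide (classifyMove ih p) S
    ...   | inj₁ noWinningMove = inj₂ (loses-moves (find someMove) λ s s∈S →
                                   All.lookup noWinningMove s∈S (All.lookup positive s∈S))
    ...   | inj₂ winningMove with find winningMove
    ...     | s , s∈S , s≤n , l = inj₁ (wins-move s s∈S s≤n l)

  hasOutcome : ∀ n → ∃ (HasOutcome S W n)
  hasOutcome n = classify (Wins⊎Loses n Left) (Wins⊎Loses n Right)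

  outcome : ℕ → Outcome
  outcome n = proj₁ (hasOutcome n)

  outcome-correct : ∀ n → HasOutcome S W n (outcome n)
  outcome-correct n = proj₂ (hasOutcome n)

  HasOutcome⇒outcome≡ : ∀ {o} → HasOutcome S W n o → outcome n ≡ o
  HasOutcome⇒outcome≡ {n} = HasOutcome-unique _ _ (outcome-correct n)

  outcome≡⇒HasOutcome : ∀ {o} → outcome n ≡ o → HasOutcome S W n o
  outcome≡⇒HasOutcome {n} refl = outcome-correct n

  HasOutcome-cong : ∀ {o} → outcome x ≡ outcome y → HasOutcome S W x o ⇔ HasOutcome S W y o
  HasOutcome-cong same = mk⇔
    (λ h → outcome≡⇒HasOutcome (trans (sym same) (HasOutcome⇒outcome≡ h)))
    (λ h → outcome≡⇒HasOutcome (trans same (HasOutcome⇒outcome≡ h)))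

  Wins-resp-outcome : outcome x ≡ outcome y → Wins S W p x → Wins S W p y
  Wins-resp-outcome {x} same =
    Wins-resp-HasOutcome _ _ (outcome-correct x) (outcome≡⇒HasOutcome (sym same))

  Loses-resp-outcome : outcome x ≡ outcome y → Loses S W p x → Loses S W p y
  Loses-resp-outcome {x} same =
    Loses-resp-HasOutcome _ _ (outcome-correct x) (outcome≡⇒HasOutcome (sym same))

  module _ {s₀ M : ℕ} (s₀∈S : s₀ ∈ S) (bounded : All (_≤ M) S) where

    ¬terminal : M ≤ n → ¬ Terminal S n
    ¬terminal M≤n t = <⇒≱ (t s₀ s₀∈S) (≤-trans (All.lookup bounded s₀∈S) M≤n)

    outcome-determinedByWindow : DeterminedByWindow M outcome
    outcome-determinedByWindow {a} {b} M≤a M≤b agree =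
      sym (HasOutcome⇒outcome≡ (HasOutcome-map wins loses _ (outcome-correct a)))
      where
      legal : ∀ {c s} → M ≤ c → s ∈ S → s ≤ c
      legal M≤c s∈S = ≤-trans (All.lookup bounded s∈S) M≤c

      agree-after : ∀ {s} → s ∈ S → outcome (a ∸ s) ≡ outcome (b ∸ s)
      agree-after {zero}  s∈S = contradiction (All.lookup positive s∈S) λ ()
      agree-after {suc k} s∈S = agree k (All.lookup bounded s∈S)

      wins : Wins S W p a → Wins S W p b
      wins (wins-terminal t _)   = contradiction t (¬terminal M≤a)
      wins (wins-move s s∈S _ l) =
        wins-move s s∈S (legal M≤b s∈S) (Loses-resp-outcome (agree-after s∈S) l)

      loses : Loses S W p a → Loses S W p b
      loses (loses-terminal t _) = contradiction t (¬terminal M≤a)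
      loses (loses-moves _ w)    = loses-moves (s₀ , s₀∈S , legal M≤b s₀∈S) λ s s∈S _ →
        Wins-resp-outcome (agree-after s∈S) (w s s∈S (legal M≤a s∈S))

proposition7 : (S : List ℕ) → S ≢ [] → All (λ s → 0 < s) S → (W : ℕ → Outcome) →
    ∃[ A ] ∃[ p ] (1 ≤ p × (∀ m → m ≥ A → ∀ o → HasOutcome S W (m + p) o ⇔ HasOutcome S W m o))
proposition7 []        S≢[] _        _ = contradiction refl S≢[]
proposition7 S@(_ ∷ _) _    positive W =
  let n₀ , p , 1≤p , periodic = determinedByWindow⇒eventuallyPeriodic Outcome↣Fin4
                                  (outcome-determinedByWindow W positive (here refl) (xs≤max 0 S))
  in n₀ , p , 1≤p , λ m m≥n₀ o → HasOutcome-cong W positive (periodic m m≥n₀)
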